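{- For every integer $k\ge 2$, every $n\ge k$, and every $(k-1)$-uniform tournament $T_n^{(k-1)}$ on $[n]$, the $k$-uniform hypergraph $H\bigl(T_n^{(k-1)}\bigr)$ contains no copy of $F^{(k)}$.
   Context: $F^{(k)}$ is the (up to isomorphism unique) $k$-uniform hypergraph on $k+1$ vertices with exactly three edges. For a nonempty finite set $X$ with $|X|=\ell$, an enumeration is a tuple $(x_1,\dots,x_\ell)$ with $X=\{x_1,\dots,x_\ell\}$; an orientation of $X$ is $\pm$ an enumeration, where $\varepsilon(x_1,\dots,x_\ell)$ and $\varepsilon'(x_{\tau(1)},\dots,x_{\tau(\ell)})$ are identified iff either $\varepsilon=\varepsilon'$ and $\tau$ is even, or $\varepsilon=-\varepsilon'$ and $\tau$ is odd (so $X$ has exactly two orientations). If $|X|\ge 2$ and $x\in X$, an orientation $\sigma$ of $X$ induces the orientation $\sigma_x$ of $X\setminus\{x\}$ obtained by choosing a representative of $\sigma$ whose enumeration ends with $x$ and deleting $x$. A $(k-1)$-uniform tournament $T_n^{(k-1)}$ on $[n]$ is a choice of one orientation for every $(k-1)$-subset of $[n]$. The $k$-uniform hypergraph $H(T_n^{(k-1)})$ has vertex set $[n]$, and $e\in[n]^{(k)}$ is an edge iff there is an orientation $\sigma$ of $e$ such that for every $x\in e$ the orientation $\sigma_x$ of $e\setminus\{x\}$ is the one chosen by $T_n^{(k-1)}$. -}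

module Defs where

open import Data.Nat using (ℕ; zero; suc; _+_; _%_; _<ᵇ_)
open import Data.Bool using (Bool; true; false; not; _∧_; if_then_else_)
open import Data.Fin using (Fin; toℕ; inject₁; fromℕ)
open import Data.Fin.Subset using (Subset; _∈_; _⊆_; ∣_∣; _-_)
open import Data.Fin.Permutation using (Permutation′; _⟨$⟩ʳ_)
open import Data.List using (List; map; allFin)
open import Data.Nat.ListAction using (sum)
open import Data.Product using (Σ; ∃; ∃-syntax; _×_; _,_; proj₁; proj₂)
open import Data.Sum using (_⊎_)
open import Function.Definitions using (Injective)
open import Relation.Binary.PropositionalEquality using (_≡_; _≢_)
open import Relation.Nullary using (¬_)

-- Signs: true = +, false = -

Sign : Set
Sign = Bool

Σ[<_]_ : (m : ℕ) → (Fin m → ℕ) → ℕ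
Σ[< m ] f = sum (map f (allFin m))

inversions : {ℓ : ℕ} → Permutation′ ℓ → ℕ
inversions {ℓ} τ =
  Σ[< ℓ ] λ i → Σ[< ℓ ] λ j →
    if (toℕ i <ᵇ toℕ j) ∧ (toℕ (τ ⟨$⟩ʳ j) <ᵇ toℕ (τ ⟨$⟩ʳ i)) then 1 else 0

EvenPerm : {ℓ : ℕ} → Permutation′ ℓ → Set
EvenPerm τ = inversions τ % 2 ≡ 0

OddPerm : {ℓ : ℕ} → Permutation′ ℓ → Set
OddPerm τ = inversions τ % 2 ≡ 1

Enumerates : {n ℓ : ℕ} → (Fin ℓ → Fin n) → Subset n → Set
Enumerates {n} {ℓ} f X =
  Injective _≡_ _≡_ f × ((x : Fin n) → (x ∈ X → ∃[ i ] f i ≡ x) × ((∃[ i ] f i ≡ x) → x ∈ X))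

-- a signed tuple ε(x₁,…,x_ℓ); an orientation is its class under _∼_
SignedTuple : ℕ → ℕ → Set
SignedTuple n ℓ = Sign × (Fin ℓ → Fin n)

_∼_ : {n ℓ : ℕ} → SignedTuple n ℓ → SignedTuple n ℓ → Set
_∼_ {n} {ℓ} (ε , f) (ε' , g) =
  Σ (Permutation′ ℓ) λ τ → ((i : Fin ℓ) → g i ≡ f (τ ⟨$⟩ʳ i))
    × ((ε ≡ ε' × EvenPerm τ) ⊎ (ε ≡ not ε' × OddPerm τ))

-- an orientation of X, given by a representative signed enumeration of X
OrientationOf : {n : ℕ} (ℓ : ℕ) → Subset n → Set
OrientationOf {n} ℓ X = Σ (SignedTuple n ℓ) λ σ → Enumerates (proj₂ σ) X

Tournament : ℕ → ℕ → Set
Tournament n ℓ = (X : Subset n) → ∣ X ∣ ≡ ℓ → OrientationOf ℓ X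

-- σ_x = ρ : some representative of σ whose enumeration ends with x,
-- with x deleted, represents ρ  (σ orientation of a (suc ℓ)-set)
InducedIs : {n ℓ : ℕ} → SignedTuple n (suc ℓ) → Fin n → SignedTuple n ℓ → Set
InducedIs {n} {ℓ} σ x ρ =
  Σ (SignedTuple n (suc ℓ)) λ σ' → (σ ∼ σ') × (proj₂ σ' (fromℕ ℓ) ≡ x)
    × ((proj₁ σ' , λ i → proj₂ σ' (inject₁ i)) ∼ ρ)

HEdge : {n ℓ : ℕ} → Tournament n ℓ → Subset n → Set
HEdge {n} {ℓ} T e =
  (∣ e ∣ ≡ suc ℓ) ×
  (Σ (SignedTuple n (suc ℓ)) λ σ → Enumerates (proj₂ σ) e ×
     ((x : Fin n) → x ∈ e → (p : ∣ e - x ∣ ≡ ℓ) →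
        InducedIs σ x (proj₁ (T (e - x) p))))

-- A k-uniform hypergraph on [n] (given by its edge predicate) contains a
-- copy of F^(k): three distinct edges contained in a common (k+1)-set.

ContainsF : {n : ℕ} (k : ℕ) → (Subset n → Set) → Set
ContainsF {n} k Edge =
  Σ (Subset n) λ V → (∣ V ∣ ≡ suc k) ×
  Σ (Subset n) λ e₁ → Σ (Subset n) λ e₂ → Σ (Subset n) λ e₃ →
    (e₁ ≢ e₂) × (e₁ ≢ e₃) × (e₂ ≢ e₃) ×
    (e₁ ⊆ V) × (e₂ ⊆ V) × (e₃ ⊆ V) ×
    Edge e₁ × Edge e₂ × Edge e₃

module Submission where

-- Give every signed tuple (ε , f) the Boolean sign
-- ε ⊕ (parity of the number of inversions of f).  Reordering an injective
-- tuple by a permutation τ changes the inversion parity by that of τ, so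
-- the sign is an invariant of orientations (sign-respects-∼).  Deleting the
-- last entry x of an enumeration of a set e removes exactly the inversions
-- formed by x, one for each element of e above x; hence if σ induces ρ on
-- e ∖ x then sgn σ = sgn ρ ⊕ parity #{y ∈ e ∣ x < y} (induced-sign).
--
-- Now let V be a (k+1)-set containing three edges of H(T); each has the
-- form V ∖ a.  The edges V ∖ a and V ∖ b share the face V ∖ {a , b}, and
-- comparing the two formulas for the sign of T on that face shows that the
-- normalised signs sgn σ_a ⊕ parity #{y ∈ V ∣ a < y} of the two edges differ
-- (adjacent-edges).  Three Booleans cannot pairwise differ, so no three
-- edges lie in a common (k+1)-set.

open import Defs
open import Algebra.Bundles using (CommutativeMonoid; CommutativeRing)
open import Data.Bool using (Bool; true; false; not; _∧_; _xor_; if_then_else_)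
open import Data.Bool.Properties
  using (not-involutive; not-distribˡ-xor; xor-same; xor-inverseʳ; xor-comm; xor-identityʳ;
         xor-annihilates-not; xor-assoc; xor-∧-commutativeRing; ∧-identityʳ)
open import Data.Empty using (⊥; ⊥-elim)
open import Data.Fin using (Fin; zero; suc; toℕ; inject₁; fromℕ; _≟_)
open import Data.Fin.Permutation using (Permutation′; _⟨$⟩ʳ_; _⟨$⟩ˡ_; inverseˡ)
open import Data.Fin.Properties using (toℕ-injective; toℕ-inject₁; inject₁-injective)
open import Data.Fin.Subset using (Subset; _∈_; _⊆_; _-_; ∣_∣)
open import Data.Fin.Subset.Properties using (drop-∷-⊆; p⊆q⇒∣p∣≤∣q∣; p─⊥≡p; p─x─y≡p─y─x; x∈p∧x≢y⇒x∈p-y)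
open import Data.List using (tabulate)
import Data.List.Properties as List
import Data.Nat.ListAction as List
open import Data.Nat using (ℕ; zero; suc; _+_; _*_; _∸_; _%_; _<ᵇ_; _≡ᵇ_; _≤_)
open import Data.Nat.Properties
  using (+-*-semiring; +-identityʳ; +-suc; +-assoc; +-cancelʳ-≡; *-identityˡ; *-distribʳ-+;
         suc-injective; ≡-irrelevant; <-irrefl; +-comm)
open import Data.Product using (Σ; ∃-syntax; _×_; _,_; proj₁; proj₂)
open import Data.Sum using (inj₁; inj₂)
open import Data.Vec using (_∷_; []; lookup)
open import Data.Vec.Properties using (lookup⇒[]=; []=⇒lookup)
open import Data.Vec.Base using (here; there)
open import Function.Definitions using (Injective)
open import Relation.Binary.PropositionalEquality
open import Relation.Nullary using (¬_; yes; no)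

open import Algebra.Properties.Semiring.Sum +-*-semiring
  using (sum; sum-cong-≗; sum-init-last; sum-replicate-zero; ∑-comm; ∑-distrib-+; ∑-permute; *-distribʳ-sum)

ind : Bool → ℕ
ind b = if b then 1 else 0

<ᵇ-irrefl : ∀ a → (a <ᵇ a) ≡ false
<ᵇ-irrefl zero    = refl
<ᵇ-irrefl (suc a) = <ᵇ-irrefl a

<ᵇ-flip : ∀ a b → a ≢ b → (b <ᵇ a) ≡ not (a <ᵇ b)
<ᵇ-flip zero    zero    a≢b = ⊥-elim (a≢b refl)
<ᵇ-flip zero    (suc b) a≢b = refl
<ᵇ-flip (suc a) zero    a≢b = refl
<ᵇ-flip (suc a) (suc b) a≢b = <ᵇ-flip a b (λ a≡b → a≢b (cong suc a≡b))

<ᵇ-trichotomy : ∀ a b → ind (a <ᵇ b) + (ind (b <ᵇ a) + ind (a ≡ᵇ b)) ≡ 1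
<ᵇ-trichotomy zero    zero    = refl
<ᵇ-trichotomy zero    (suc b) = refl
<ᵇ-trichotomy (suc a) zero    = refl
<ᵇ-trichotomy (suc a) (suc b) = <ᵇ-trichotomy a b

≡ᵇ-sound : ∀ a b → (a ≡ᵇ b) ≡ true → a ≡ b
≡ᵇ-sound zero    zero    _  = refl
≡ᵇ-sound (suc a) (suc b) eq = cong suc (≡ᵇ-sound a b eq)

≡ᵇ-refl : ∀ a → (a ≡ᵇ a) ≡ true
≡ᵇ-refl zero    = refl
≡ᵇ-refl (suc a) = ≡ᵇ-refl a

≡ᵇ-false : ∀ a b → a ≢ b → (a ≡ᵇ b) ≡ false
≡ᵇ-false zero    zero    a≢b = ⊥-elim (a≢b refl)
≡ᵇ-false zero    (suc b) a≢b = refl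
≡ᵇ-false (suc a) zero    a≢b = refl
≡ᵇ-false (suc a) (suc b) a≢b = ≡ᵇ-false a b (λ a≡b → a≢b (cong suc a≡b))

_≺_ : ∀ {n} → Fin n → Fin n → Bool
i ≺ j = toℕ i <ᵇ toℕ j

_≐_ : ∀ {n} → Fin n → Fin n → Bool
i ≐ j = toℕ i ≡ᵇ toℕ j

≺-irrefl : ∀ {n} (i : Fin n) → (i ≺ i) ≡ false
≺-irrefl i = <ᵇ-irrefl (toℕ i)

≺-flip : ∀ {n} (i j : Fin n) → i ≢ j → (j ≺ i) ≡ not (i ≺ j)
≺-flip i j i≢j = <ᵇ-flip (toℕ i) (toℕ j) (λ eq → i≢j (toℕ-injective eq))

≺⇒≢ : ∀ {n} (i j : Fin n) → (i ≺ j) ≡ true → i ≢ j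
≺⇒≢ i .i i≺i refl with trans (sym i≺i) (≺-irrefl i)
... | ()

≐-sound : ∀ {n} (i j : Fin n) → (i ≐ j) ≡ true → i ≡ j
≐-sound i j eq = toℕ-injective (≡ᵇ-sound (toℕ i) (toℕ j) eq)

≐-refl : ∀ {n} (i : Fin n) → (i ≐ i) ≡ true
≐-refl i = ≡ᵇ-refl (toℕ i)

≐-false : ∀ {n} (i j : Fin n) → i ≢ j → (i ≐ j) ≡ false
≐-false i j i≢j = ≡ᵇ-false (toℕ i) (toℕ j) (λ eq → i≢j (toℕ-injective eq))

par : ℕ → Bool
par zero    = false
par (suc n) = not (par n)

par-+ : ∀ a b → par (a + b) ≡ par a xor par b
par-+ zero    b = refl
par-+ (suc a) b = trans (cong not (par-+ a b)) (not-distribˡ-xor (par a) (par b))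

par-double : ∀ a → par (a + a) ≡ false
par-double a = trans (par-+ a a) (xor-same (par a))

par-ind : ∀ b → par (ind b) ≡ b
par-ind true  = refl
par-ind false = refl

%2≡ind-par : ∀ n → n % 2 ≡ ind (par n)
%2≡ind-par zero          = refl
%2≡ind-par (suc zero)    = refl
%2≡ind-par (suc (suc n)) = trans (%2≡ind-par n) (cong ind (sym (not-involutive (par n))))

even⇒par-false : ∀ n → n % 2 ≡ 0 → par n ≡ false
even⇒par-false n even with par n | %2≡ind-par n
... | false | _    = refl
... | true  | n%2 with trans (sym n%2) even
...   | ()

odd⇒par-true : ∀ n → n % 2 ≡ 1 → par n ≡ true
odd⇒par-true n odd with par n | %2≡ind-par n
... | true  | _    = refl
... | false | n%2 with trans (sym n%2) odd
...   | ()

Σ[<]≡sum : ∀ m (f : Fin m → ℕ) → Σ[< m ] f ≡ sum f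
Σ[<]≡sum m f = trans (cong List.sum (List.map-tabulate (λ i → i) f)) (sum-tabulate m f)
  where
  sum-tabulate : ∀ m (f : Fin m → ℕ) → List.sum (tabulate f) ≡ sum f
  sum-tabulate zero    f = refl
  sum-tabulate (suc m) f = cong (f zero +_) (sum-tabulate m (λ i → f (suc i)))

sum-delta : ∀ {m} (a : Fin m) (P : Fin m → ℕ) → sum (λ y → ind (a ≐ y) * P y) ≡ P a
sum-delta {suc m} zero    P = trans (cong₂ _+_ (+-identityʳ (P zero)) (sum-replicate-zero m)) (+-identityʳ (P zero))
sum-delta {suc m} (suc a) P = sum-delta a (λ y → P (suc y))

sum-perm : ∀ {m} (τ : Permutation′ m) (f : Fin m → ℕ) → sum (λ i → f (τ ⟨$⟩ʳ i)) ≡ sum f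
sum-perm τ f = sym (∑-permute f τ)

∑∑ : ∀ {m} → (Fin m → Fin m → ℕ) → ℕ
∑∑ g = sum λ i → sum (g i)

∑∑-cong : ∀ {m} {g h : Fin m → Fin m → ℕ} → (∀ i j → g i j ≡ h i j) → ∑∑ g ≡ ∑∑ h
∑∑-cong g≡h = sum-cong-≗ (λ i → sum-cong-≗ (g≡h i))

∑∑-distrib-+ : ∀ {m} (g h : Fin m → Fin m → ℕ) → ∑∑ (λ i j → g i j + h i j) ≡ ∑∑ g + ∑∑ h
∑∑-distrib-+ g h = trans (sum-cong-≗ (λ i → ∑-distrib-+ (g i) (h i))) (∑-distrib-+ (λ i → sum (g i)) (λ i → sum (h i)))

∑∑-perm : ∀ {m} (τ : Permutation′ m) (g : Fin m → Fin m → ℕ) → ∑∑ (λ i j → g (τ ⟨$⟩ʳ i) (τ ⟨$⟩ʳ j)) ≡ ∑∑ g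
∑∑-perm τ g = trans (sum-cong-≗ (λ i → sum-perm τ (g (τ ⟨$⟩ʳ i)))) (sum-perm τ (λ i → sum (g i)))

upper : ∀ {m} → (Fin m → Fin m → ℕ) → ℕ
upper g = ∑∑ λ i j → ind (i ≺ j) * g i j

diagonal : ∀ {m} → (Fin m → Fin m → ℕ) → ℕ
diagonal g = ∑∑ λ i j → ind (i ≐ j) * g i j

diagonal≡ : ∀ {m} (g : Fin m → Fin m → ℕ) → diagonal g ≡ sum (λ i → g i i)
diagonal≡ g = sum-cong-≗ (λ i → sum-delta i (g i))

symmetric-split : ∀ {m} (g : Fin m → Fin m → ℕ) → (∀ i j → g i j ≡ g j i) →
                  ∑∑ g ≡ upper g + (upper g + diagonal g)
symmetric-split g g-sym = begin
  ∑∑ g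
    ≡⟨ ∑∑-cong (λ i j → split (i ≺ j) (j ≺ i) (i ≐ j) (g i j) (<ᵇ-trichotomy (toℕ i) (toℕ j))) ⟩
  ∑∑ (λ i j → ind (i ≺ j) * g i j + (ind (j ≺ i) * g i j + ind (i ≐ j) * g i j))
    ≡⟨ ∑∑-distrib-+ (λ i j → ind (i ≺ j) * g i j) _ ⟩
  upper g + ∑∑ (λ i j → ind (j ≺ i) * g i j + ind (i ≐ j) * g i j)
    ≡⟨ cong (upper g +_) (∑∑-distrib-+ (λ i j → ind (j ≺ i) * g i j) _) ⟩
  upper g + (∑∑ (λ i j → ind (j ≺ i) * g i j) + diagonal g)
    ≡⟨ cong (λ lower → upper g + (lower + diagonal g)) lower≡upper ⟩
  upper g + (upper g + diagonal g) ∎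
  where
  open ≡-Reasoning
  split : ∀ x y z a → ind x + (ind y + ind z) ≡ 1 → a ≡ ind x * a + (ind y * a + ind z * a)
  split x y z a one = begin
    a                                   ≡⟨ sym (*-identityˡ a) ⟩
    1 * a                               ≡⟨ cong (_* a) (sym one) ⟩
    (ind x + (ind y + ind z)) * a       ≡⟨ *-distribʳ-+ a (ind x) _ ⟩
    ind x * a + (ind y + ind z) * a     ≡⟨ cong (ind x * a +_) (*-distribʳ-+ a (ind y) (ind z)) ⟩
    ind x * a + (ind y * a + ind z * a) ∎
  lower≡upper : ∑∑ (λ i j → ind (j ≺ i) * g i j) ≡ upper g
  lower≡upper = trans (∑-comm (λ i j → ind (j ≺ i) * g i j))
                      (∑∑-cong (λ j i → cong (ind (j ≺ i) *_) (g-sym i j)))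

double-injective : ∀ a b → a + a ≡ b + b → a ≡ b
double-injective zero    zero    _  = refl
double-injective (suc a) (suc b) eq =
  cong suc (double-injective a b (suc-injective (trans (sym (+-suc a a)) (trans (suc-injective eq) (+-suc b b)))))

-- The upper part of a symmetric kernel is invariant under relabelling by a
-- permutation, since the full sum and the diagonal are.
upper-perm : ∀ {m} (τ : Permutation′ m) (g : Fin m → Fin m → ℕ) → (∀ i j → g i j ≡ g j i) →
             upper (λ i j → g (τ ⟨$⟩ʳ i) (τ ⟨$⟩ʳ j)) ≡ upper g
upper-perm τ g g-sym =
  double-injective _ _ (+-cancelʳ-≡ (diagonal g) _ _
    (trans (+-assoc uτ uτ (diagonal g)) (trans twice (sym (+-assoc u u (diagonal g))))))
  where
  gτ = λ i j → g (τ ⟨$⟩ʳ i) (τ ⟨$⟩ʳ j)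
  uτ = upper gτ
  u  = upper g
  diagonal-perm : diagonal gτ ≡ diagonal g
  diagonal-perm = trans (diagonal≡ gτ) (trans (sum-perm τ (λ i → g i i)) (sym (diagonal≡ g)))
  twice : uτ + (uτ + diagonal g) ≡ u + (u + diagonal g)
  twice = begin
    uτ + (uτ + diagonal g)  ≡⟨ cong (λ d → uτ + (uτ + d)) (sym diagonal-perm) ⟩
    uτ + (uτ + diagonal gτ) ≡⟨ sym (symmetric-split gτ (λ i j → g-sym _ _)) ⟩
    ∑∑ gτ                   ≡⟨ ∑∑-perm τ g ⟩
    ∑∑ g                    ≡⟨ symmetric-split g g-sym ⟩
    u + (u + diagonal g)    ∎
    where open ≡-Reasoning

inv : ∀ {ℓ n} → (Fin ℓ → Fin n) → ℕ
inv f = ∑∑ λ i j → ind (i ≺ j ∧ f j ≺ f i)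

inversions≡inv : ∀ {ℓ} (τ : Permutation′ ℓ) → inversions τ ≡ inv (τ ⟨$⟩ʳ_)
inversions≡inv {ℓ} τ = trans (Σ[<]≡sum ℓ _) (sum-cong-≗ (λ i → Σ[<]≡sum ℓ (λ j → ind (i ≺ j ∧ (τ ⟨$⟩ʳ j) ≺ (τ ⟨$⟩ʳ i)))))

inv-cong : ∀ {ℓ n} {f g : Fin ℓ → Fin n} → (∀ i → f i ≡ g i) → inv f ≡ inv g
inv-cong f≗g = ∑∑-cong (λ i j → cong₂ (λ fj fi → ind (i ≺ j ∧ fj ≺ fi)) (f≗g j) (f≗g i))

perm-injective : ∀ {ℓ} (τ : Permutation′ ℓ) → Injective _≡_ _≡_ (τ ⟨$⟩ʳ_)
perm-injective τ {i} {j} eq = trans (sym (inverseˡ τ)) (trans (cong (τ ⟨$⟩ˡ_) eq) (inverseˡ τ))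

-- For a pair i < j with p = τ i, q = τ j (so a = true, b = [q < p],
-- c = [f q < f p], u = [p < q], v = [f p < f q]) the pair's contributions
-- to inv (f ∘ τ) and inv τ add up to the symmetric quantity
-- [p < q ∧ f q < f p] + [q < p ∧ f p < f q] plus an even correction.
pair-contribution : ∀ (a b c u v : Bool) → (a ≡ true → u ≡ not b) → (a ≡ true → v ≡ not c) →
  ind (a ∧ c) + ind (a ∧ b) ≡ ind a * (ind (u ∧ c) + ind (b ∧ v)) + (ind (a ∧ b ∧ c) + ind (a ∧ b ∧ c))
pair-contribution false b c u v _ _ = refl
pair-contribution true b c u v u≡¬b v≡¬c rewrite u≡¬b refl | v≡¬c refl with b | c
... | true  | true  = refl
... | true  | false = refl
... | false | true  = refl
... | false | false = refl

-- On the upper triangle (x = [p < q], so y = [q < p] is false) only the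
-- first summand of the symmetric quantity survives.
upper-only-first : ∀ (x y z w : Bool) → (x ≡ true → y ≡ false) →
                   ind x * (ind (x ∧ z) + ind (y ∧ w)) ≡ ind (x ∧ z)
upper-only-first false y z w _ = refl
upper-only-first true  y z w y≡false rewrite y≡false refl with z
... | true  = refl
... | false = refl

inv-∘-perm : ∀ {ℓ n} (f : Fin ℓ → Fin n) → Injective _≡_ _≡_ f → (τ : Permutation′ ℓ) →
             ∃[ K ] inv (λ i → f (τ ⟨$⟩ʳ i)) + inv (τ ⟨$⟩ʳ_) ≡ inv f + (K + K)
inv-∘-perm f f-inj τ = ∑∑ both , (begin
  inv fτ + inv t
    ≡⟨ sym (∑∑-distrib-+ (λ i j → ind (i ≺ j ∧ fτ j ≺ fτ i)) _) ⟩
  ∑∑ (λ i j → ind (i ≺ j ∧ fτ j ≺ fτ i) + ind (i ≺ j ∧ t j ≺ t i))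
    ≡⟨ ∑∑-cong pair ⟩
  ∑∑ (λ i j → ind (i ≺ j) * h (t i) (t j) + (both i j + both i j))
    ≡⟨ ∑∑-distrib-+ (λ i j → ind (i ≺ j) * h (t i) (t j)) _ ⟩
  upper (λ i j → h (t i) (t j)) + ∑∑ (λ i j → both i j + both i j)
    ≡⟨ cong₂ _+_ (upper-perm τ h h-sym) (∑∑-distrib-+ both both) ⟩
  upper h + (∑∑ both + ∑∑ both)
    ≡⟨ cong (_+ (∑∑ both + ∑∑ both)) (∑∑-cong upper-h) ⟩
  inv f + (∑∑ both + ∑∑ both) ∎)
  where
  open ≡-Reasoning
  t  = τ ⟨$⟩ʳ_
  fτ = λ i → f (t i)
  h : _ → _ → ℕ
  h p q = ind (p ≺ q ∧ f q ≺ f p) + ind (q ≺ p ∧ f p ≺ f q)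
  h-sym : ∀ p q → h p q ≡ h q p
  h-sym p q = +-comm (ind (p ≺ q ∧ f q ≺ f p)) _
  both : _ → _ → ℕ
  both i j = ind (i ≺ j ∧ t j ≺ t i ∧ fτ j ≺ fτ i)
  pair : ∀ i j → ind (i ≺ j ∧ fτ j ≺ fτ i) + ind (i ≺ j ∧ t j ≺ t i)
                 ≡ ind (i ≺ j) * h (t i) (t j) + (both i j + both i j)
  pair i j = pair-contribution (i ≺ j) (t j ≺ t i) (fτ j ≺ fτ i) (t i ≺ t j) (fτ i ≺ fτ j)
    (λ i≺j → ≺-flip (t j) (t i) (λ eq → ≺⇒≢ i j i≺j (sym (perm-injective τ eq))))
    (λ i≺j → ≺-flip (fτ j) (fτ i) (λ eq → ≺⇒≢ i j i≺j (sym (perm-injective τ (f-inj eq)))))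
  upper-h : ∀ p q → ind (p ≺ q) * h p q ≡ ind (p ≺ q ∧ f q ≺ f p)
  upper-h p q = upper-only-first (p ≺ q) (q ≺ p) (f q ≺ f p) (f p ≺ f q)
    (λ p≺q → trans (≺-flip p q (≺⇒≢ p q p≺q)) (cong not p≺q))

par-inv-∘-perm : ∀ {ℓ n} (f : Fin ℓ → Fin n) → Injective _≡_ _≡_ f → (τ : Permutation′ ℓ) →
                 par (inv f) ≡ par (inv (λ i → f (τ ⟨$⟩ʳ i))) xor par (inversions τ)
par-inv-∘-perm f f-inj τ with inv-∘-perm f f-inj τ
... | K , eq = begin
  par (inv f)                                           ≡⟨ sym (xor-identityʳ _) ⟩
  par (inv f) xor false                                 ≡⟨ cong (par (inv f) xor_) (sym (par-double K)) ⟩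
  par (inv f) xor par (K + K)                           ≡⟨ sym (par-+ (inv f) (K + K)) ⟩
  par (inv f + (K + K))                                 ≡⟨ cong par (sym eq) ⟩
  par (inv fτ + inv (τ ⟨$⟩ʳ_))                          ≡⟨ par-+ (inv fτ) _ ⟩
  par (inv fτ) xor par (inv (τ ⟨$⟩ʳ_))                  ≡⟨ cong (λ k → par (inv fτ) xor par k) (sym (inversions≡inv τ)) ⟩
  par (inv fτ) xor par (inversions τ)                   ∎
  where
  open ≡-Reasoning
  fτ = λ i → f (τ ⟨$⟩ʳ i)

sgn : ∀ {n ℓ} → SignedTuple n ℓ → Bool
sgn (ε , f) = ε xor par (inv f)

sign-respects-∼ : ∀ {n ℓ} (σ ρ : SignedTuple n ℓ) → Injective _≡_ _≡_ (proj₂ σ) → σ ∼ ρ → sgn σ ≡ sgn ρ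
sign-respects-∼ (ε , f) (ε' , g) f-inj (τ , g≗fτ , inj₁ (refl , even)) = cong (ε xor_) (begin
  par (inv f)                          ≡⟨ par-inv-∘-perm f f-inj τ ⟩
  par (inv fτ) xor par (inversions τ)  ≡⟨ cong₂ _xor_ (cong par (inv-cong (λ i → sym (g≗fτ i))))
                                                       (even⇒par-false (inversions τ) even) ⟩
  par (inv g) xor false                ≡⟨ xor-identityʳ _ ⟩
  par (inv g)                          ∎)
  where
  open ≡-Reasoning
  fτ = λ i → f (τ ⟨$⟩ʳ i)
sign-respects-∼ (._ , f) (ε' , g) f-inj (τ , g≗fτ , inj₂ (refl , odd)) = begin
  not ε' xor par (inv f)                           ≡⟨ cong (not ε' xor_) (par-inv-∘-perm f f-inj τ) ⟩
  not ε' xor (par (inv fτ) xor par (inversions τ)) ≡⟨ cong (not ε' xor_) (cong₂ _xor_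
                                                        (cong par (inv-cong (λ i → sym (g≗fτ i))))
                                                        (odd⇒par-true (inversions τ) odd)) ⟩
  not ε' xor (par (inv g) xor true)                ≡⟨ cong (not ε' xor_) (xor-comm (par (inv g)) true) ⟩
  not ε' xor not (par (inv g))                     ≡⟨ xor-annihilates-not ε' _ ⟩
  ε' xor par (inv g)                               ∎
  where
  open ≡-Reasoning
  fτ = λ i → f (τ ⟨$⟩ʳ i)

entries-above : ∀ {ℓ n} → (Fin ℓ → Fin n) → Fin n → ℕ
entries-above f x = sum λ i → ind (x ≺ f i)

≺-inject₁ : ∀ {m} (i j : Fin m) → (inject₁ i ≺ inject₁ j) ≡ (i ≺ j)
≺-inject₁ i j = cong₂ _<ᵇ_ (toℕ-inject₁ i) (toℕ-inject₁ j)

fromℕ-≺-inject₁ : ∀ {m} (j : Fin m) → (fromℕ m ≺ inject₁ j) ≡ false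
fromℕ-≺-inject₁ zero    = refl
fromℕ-≺-inject₁ (suc j) = fromℕ-≺-inject₁ j

inject₁-≺-fromℕ : ∀ {m} (i : Fin m) → (inject₁ i ≺ fromℕ m) ≡ true
inject₁-≺-fromℕ zero    = refl
inject₁-≺-fromℕ (suc i) = inject₁-≺-fromℕ i

inv-init-last : ∀ {n} m (f : Fin (suc m) → Fin n) →
                inv f ≡ inv (λ i → f (inject₁ i)) + entries-above f (f (fromℕ m))
inv-init-last m f = begin
  inv f
    ≡⟨ sum-init-last (λ i → sum (F i)) ⟩
  sum (λ i → sum (F (inject₁ i))) + sum (F (fromℕ m))
    ≡⟨ cong₂ _+_ (sum-cong-≗ earlier-row) last-row ⟩
  sum (λ i → sum (G i) + c i) + 0
    ≡⟨ +-identityʳ _ ⟩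
  sum (λ i → sum (G i) + c i)
    ≡⟨ ∑-distrib-+ (λ i → sum (G i)) c ⟩
  inv g + sum c
    ≡⟨ cong (inv g +_) (sym last-above) ⟩
  inv g + entries-above f x ∎
  where
  open ≡-Reasoning
  F = λ (i j : Fin (suc m)) → ind (i ≺ j ∧ f j ≺ f i)
  g = λ i → f (inject₁ i)
  x = f (fromℕ m)
  G = λ (i j : Fin m) → ind (i ≺ j ∧ g j ≺ g i)
  c = λ (i : Fin m) → ind (x ≺ g i)
  -- an earlier entry forms an inversion with the last entry x iff it lies above x
  earlier-row : ∀ i → sum (F (inject₁ i)) ≡ sum (G i) + c i
  earlier-row i = trans (sum-init-last (F (inject₁ i)))
    (cong₂ _+_ (sum-cong-≗ (λ j → cong (λ b → ind (b ∧ g j ≺ g i)) (≺-inject₁ i j)))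
               (cong (λ b → ind (b ∧ x ≺ g i)) (inject₁-≺-fromℕ i)))
  -- no position comes after the last one
  last-row : sum (F (fromℕ m)) ≡ 0
  last-row = trans (sum-init-last (F (fromℕ m)))
    (cong₂ _+_ (trans (sum-cong-≗ (λ j → cong (λ b → ind (b ∧ g j ≺ x)) (fromℕ-≺-inject₁ j)))
                      (sum-replicate-zero m))
               (cong (λ b → ind (b ∧ x ≺ x)) (≺-irrefl (fromℕ m))))
  last-above : entries-above f x ≡ sum c
  last-above = trans (sum-init-last (λ i → ind (x ≺ f i)))
                     (trans (cong (λ b → sum c + ind b) (≺-irrefl x)) (+-identityʳ _))

above : ∀ {n} → Subset n → Fin n → ℕ
above e x = sum λ y → ind (lookup e y) * ind (x ≺ y)

enumeration-multiplicity : ∀ {ℓ n} (f : Fin ℓ → Fin n) (e : Subset n) → Enumerates f e → (y : Fin n) →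
                           sum (λ i → ind (f i ≐ y)) ≡ ind (lookup e y)
enumeration-multiplicity f e (f-inj , f-onto) y with lookup e y in y∈?e
... | true with proj₁ (f-onto y) (lookup⇒[]= y e y∈?e)
...   | i₀ , refl = trans (sum-cong-≗ hits) (sum-delta i₀ (λ _ → 1))
  where
  hits : ∀ i → ind (f i ≐ f i₀) ≡ ind (i₀ ≐ i) * 1
  hits i with i ≟ i₀
  ... | yes refl rewrite ≐-refl (f i) | ≐-refl i = refl
  ... | no i≢i₀ rewrite ≐-false (f i) (f i₀) (λ eq → i≢i₀ (f-inj eq))
                      | ≐-false i₀ i (λ eq → i≢i₀ (sym eq)) = refl
enumeration-multiplicity {ℓ} f e (f-inj , f-onto) y | false =
  trans (sum-cong-≗ misses) (sum-replicate-zero ℓ)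
  where
  misses : ∀ i → ind (f i ≐ y) ≡ 0
  misses i with f i ≐ y in fi≐y
  ... | false = refl
  ... | true with trans (sym y∈?e) ([]=⇒lookup (proj₂ (f-onto y) (i , ≐-sound (f i) y fi≐y)))
  ...   | ()

sum-over-enumeration : ∀ {ℓ n} (f : Fin ℓ → Fin n) (e : Subset n) → Enumerates f e → (P : Fin n → ℕ) →
                       sum (λ i → P (f i)) ≡ sum (λ y → ind (lookup e y) * P y)
sum-over-enumeration f e f-enum P = sym (begin
  sum (λ y → ind (lookup e y) * P y)
    ≡⟨ sum-cong-≗ (λ y → cong (_* P y) (sym (enumeration-multiplicity f e f-enum y))) ⟩
  sum (λ y → sum (λ i → ind (f i ≐ y)) * P y)
    ≡⟨ sum-cong-≗ (λ y → *-distribʳ-sum (P y) (λ i → ind (f i ≐ y))) ⟩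
  sum (λ y → sum (λ i → ind (f i ≐ y) * P y))
    ≡⟨ ∑-comm (λ y i → ind (f i ≐ y) * P y) ⟩
  sum (λ i → sum (λ y → ind (f i ≐ y) * P y))
    ≡⟨ sum-cong-≗ (λ i → sum-delta (f i) P) ⟩
  sum (λ i → P (f i)) ∎)
  where open ≡-Reasoning

lookup-minus : ∀ {n} (p : Subset n) a y → lookup (p - a) y ≡ lookup p y ∧ not (a ≐ y)
lookup-minus (true  ∷ p) zero    zero    = refl
lookup-minus (false ∷ p) zero    zero    = refl
lookup-minus (v     ∷ p) zero    (suc y) = trans (cong (λ q → lookup q y) (p─⊥≡p p)) (sym (∧-identityʳ _))
lookup-minus (v     ∷ p) (suc a) zero    = sym (∧-identityʳ v)
lookup-minus (v     ∷ p) (suc a) (suc y) = lookup-minus p a y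

∣-∣-minus : ∀ {n} (e : Subset n) x → x ∈ e → suc ∣ e - x ∣ ≡ ∣ e ∣
∣-∣-minus (true ∷ e) zero    here        = cong suc (cong ∣_∣ (p─⊥≡p e))
∣-∣-minus (true ∷ e) (suc x) (there x∈e) = cong suc (∣-∣-minus e x x∈e)
∣-∣-minus (false ∷ e) (suc x) (there x∈e) = ∣-∣-minus e x x∈e

⊆-same-size⇒≡ : ∀ {n} (X V : Subset n) → X ⊆ V → ∣ X ∣ ≡ ∣ V ∣ → X ≡ V
⊆-same-size⇒≡ []          []          X⊆V eq = refl
⊆-same-size⇒≡ (true ∷ X)  (true ∷ V)  X⊆V eq = cong (true ∷_) (⊆-same-size⇒≡ X V (drop-∷-⊆ X⊆V) (suc-injective eq))
⊆-same-size⇒≡ (false ∷ X) (false ∷ V) X⊆V eq = cong (false ∷_) (⊆-same-size⇒≡ X V (drop-∷-⊆ X⊆V) eq)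
⊆-same-size⇒≡ (true ∷ X)  (false ∷ V) X⊆V eq with X⊆V here
... | ()
⊆-same-size⇒≡ (false ∷ X) (true ∷ V)  X⊆V eq =
  ⊥-elim (<-irrefl refl (subst (_≤ ∣ V ∣) eq (p⊆q⇒∣p∣≤∣q∣ (drop-∷-⊆ X⊆V))))

⊆-one-smaller : ∀ {n} (X V : Subset n) → X ⊆ V → ∣ V ∣ ≡ suc ∣ X ∣ → ∃[ a ] a ∈ V × X ≡ V - a
⊆-one-smaller (true ∷ X) (true ∷ V) X⊆V eq with ⊆-one-smaller X V (drop-∷-⊆ X⊆V) (suc-injective eq)
... | a , a∈V , X≡V-a = suc a , there a∈V , cong (true ∷_) X≡V-a
⊆-one-smaller (false ∷ X) (false ∷ V) X⊆V eq with ⊆-one-smaller X V (drop-∷-⊆ X⊆V) eq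
... | a , a∈V , X≡V-a = suc a , there a∈V , cong (false ∷_) X≡V-a
⊆-one-smaller (true ∷ X) (false ∷ V) X⊆V eq with X⊆V here
... | ()
⊆-one-smaller (false ∷ X) (true ∷ V) X⊆V eq =
  zero , here , cong (false ∷_) (trans (⊆-same-size⇒≡ X V (drop-∷-⊆ X⊆V) (sym (suc-injective eq))) (sym (p─⊥≡p V)))

above-minus : ∀ {n} (V : Subset n) a b → a ∈ V → above (V - a) b + ind (b ≺ a) ≡ above V b
above-minus V a b a∈V = begin
  above (V - a) b + ind (b ≺ a)
    ≡⟨ cong₂ _+_ (sum-cong-≗ (λ y → cong (λ v → ind v * ind (b ≺ y)) (lookup-minus V a y))) (sym at-a) ⟩
  sum (λ y → ind (lookup V y ∧ not (a ≐ y)) * ind (b ≺ y)) + sum (λ y → ind (a ≐ y) * (ind (lookup V y) * ind (b ≺ y)))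
    ≡⟨ sym (∑-distrib-+ (λ y → ind (lookup V y ∧ not (a ≐ y)) * ind (b ≺ y)) _) ⟩
  sum (λ y → ind (lookup V y ∧ not (a ≐ y)) * ind (b ≺ y) + ind (a ≐ y) * (ind (lookup V y) * ind (b ≺ y)))
    ≡⟨ sum-cong-≗ (λ y → split (lookup V y) (a ≐ y) (ind (b ≺ y))) ⟩
  above V b ∎
  where
  open ≡-Reasoning
  at-a : sum (λ y → ind (a ≐ y) * (ind (lookup V y) * ind (b ≺ y))) ≡ ind (b ≺ a)
  at-a = trans (sum-delta a (λ y → ind (lookup V y) * ind (b ≺ y)))
               (trans (cong (λ v → ind v * ind (b ≺ a)) ([]=⇒lookup a∈V)) (+-identityʳ _))
  split : ∀ v e l → ind (v ∧ not e) * l + ind e * (ind v * l) ≡ ind v * l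
  split true  true  l = +-identityʳ (l + 0)
  split true  false l = +-identityʳ (l + 0)
  split false true  l = refl
  split false false l = refl

induced-sign : ∀ {n m} (σ : SignedTuple n (suc m)) (e : Subset n) → Enumerates (proj₂ σ) e →
               (x : Fin n) (ρ : SignedTuple n m) → InducedIs σ x ρ → sgn σ ≡ sgn ρ xor par (above e x)
induced-sign {m = m} (ε , f) e f-enum x ρ ((ε' , f') , σ∼σ'@(τ , f'≗fτ , _) , last≡x , init∼ρ) = begin
  sgn (ε , f)
    ≡⟨ sign-respects-∼ (ε , f) (ε' , f') f-inj σ∼σ' ⟩
  ε' xor par (inv f')
    ≡⟨ cong (λ k → ε' xor par k) (inv-init-last m f') ⟩
  ε' xor par (inv init + entries-above f' (f' (fromℕ m)))
    ≡⟨ cong (ε' xor_) (par-+ (inv init) _) ⟩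
  ε' xor (par (inv init) xor par (entries-above f' (f' (fromℕ m))))
    ≡⟨ sym (xor-assoc ε' _ _) ⟩
  sgn (ε' , init) xor par (entries-above f' (f' (fromℕ m)))
    ≡⟨ cong₂ (λ s k → s xor par k) (sign-respects-∼ (ε' , init) ρ init-inj init∼ρ) entries≡above ⟩
  sgn ρ xor par (above e x) ∎
  where
  open ≡-Reasoning
  f-inj = proj₁ f-enum
  init = λ i → f' (inject₁ i)
  f'-inj : Injective _≡_ _≡_ f'
  f'-inj {i} {j} eq = perm-injective τ (f-inj (trans (sym (f'≗fτ i)) (trans eq (f'≗fτ j))))
  init-inj : Injective _≡_ _≡_ init
  init-inj eq = inject₁-injective (f'-inj eq)
  entries≡above : entries-above f' (f' (fromℕ m)) ≡ above e x
  entries≡above = begin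
    entries-above f' (f' (fromℕ m))    ≡⟨ cong (entries-above f') last≡x ⟩
    entries-above f' x                 ≡⟨ sum-cong-≗ (λ i → cong (λ y → ind (x ≺ y)) (f'≗fτ i)) ⟩
    sum (λ i → ind (x ≺ f (τ ⟨$⟩ʳ i))) ≡⟨ sum-perm τ (λ i → ind (x ≺ f i)) ⟩
    entries-above f x                  ≡⟨ sum-over-enumeration f e f-enum (λ y → ind (x ≺ y)) ⟩
    above e x                          ∎

EdgeOrientation : ∀ {n m} → Tournament n m → Subset n → Set
EdgeOrientation {n} {m} T e =
  Σ (SignedTuple n (suc m)) λ σ → Enumerates (proj₂ σ) e ×
    ((x : Fin n) → x ∈ e → (p : ∣ e - x ∣ ≡ m) → InducedIs σ x (proj₁ (T (e - x) p)))

normal-sign : ∀ {n m} (T : Tournament n m) (V : Subset n) (a : Fin n) → EdgeOrientation T (V - a) → Bool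
normal-sign T V a (σ , _) = sgn σ xor par (above V a)

T-irrelevant : ∀ {n m} (T : Tournament n m) {X Y : Subset n} → X ≡ Y → (p : ∣ X ∣ ≡ m) (q : ∣ Y ∣ ≡ m) →
               proj₁ (T X p) ≡ proj₁ (T Y q)
T-irrelevant T {X} refl p q = cong (λ r → proj₁ (T X r)) (≡-irrelevant p q)

∣V-a-b∣ : ∀ {n m} (V : Subset n) a b → a ∈ V → b ∈ V → b ≢ a → ∣ V ∣ ≡ suc (suc m) → ∣ V - a - b ∣ ≡ m
∣V-a-b∣ V a b a∈V b∈V b≢a ∣V∣ =
  suc-injective (suc-injective (begin
    suc (suc ∣ V - a - b ∣) ≡⟨ cong suc (∣-∣-minus (V - a) b (x∈p∧x≢y⇒x∈p-y b∈V b≢a)) ⟩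
    suc ∣ V - a ∣           ≡⟨ ∣-∣-minus V a a∈V ⟩
    ∣ V ∣                   ≡⟨ ∣V∣ ⟩
    suc (suc _)             ∎))
  where open ≡-Reasoning

xor-solve : ∀ u c w → u xor c ≡ w → u ≡ w xor c
xor-solve u c w eq = begin
  u                 ≡⟨ sym (xor-identityʳ u) ⟩
  u xor false       ≡⟨ cong (u xor_) (sym (xor-same c)) ⟩
  u xor (c xor c)   ≡⟨ sym (xor-assoc u c c) ⟩
  (u xor c) xor c   ≡⟨ cong (_xor c) eq ⟩
  w xor c           ∎
  where open ≡-Reasoning

edge-sign-at-face : ∀ {n m} (T : Tournament n m) (V : Subset n) a b → a ∈ V → b ∈ V → b ≢ a →
                    (w : EdgeOrientation T (V - a)) (p : ∣ V - a - b ∣ ≡ m) →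
                    sgn (proj₁ w) ≡ sgn (proj₁ (T (V - a - b) p)) xor (par (above V b) xor (b ≺ a))
edge-sign-at-face T V a b a∈V b∈V b≢a (σ , σ-enum , σ-induces) p =
  trans (induced-sign σ (V - a) σ-enum b _ (σ-induces b b∈V-a p))
        (cong (sgn (proj₁ (T (V - a - b) p)) xor_) parity-above)
  where
  b∈V-a = x∈p∧x≢y⇒x∈p-y b∈V b≢a
  parity-above : par (above (V - a) b) ≡ par (above V b) xor (b ≺ a)
  parity-above = xor-solve _ (b ≺ a) _
    (trans (cong (par (above (V - a) b) xor_) (sym (par-ind (b ≺ a))))
           (trans (sym (par-+ (above (V - a) b) (ind (b ≺ a)))) (cong par (above-minus V a b a∈V))))

xor-monoid : CommutativeMonoid _ _
xor-monoid = CommutativeRing.+-commutativeMonoid xor-∧-commutativeRing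

cross-cancel : ∀ r x y u → ((r xor (y xor u)) xor x) xor ((r xor (x xor not u)) xor y) ≡ true
cross-cancel r x y u = begin
  ((r xor (y xor u)) xor x) xor ((r xor (x xor not u)) xor y)
    ≡⟨ rearrange r x y u (not u) ⟩
  (r xor r) xor ((x xor x) xor ((y xor y) xor (u xor not u)))
    ≡⟨ cong₂ _xor_ (xor-same r) (cong₂ _xor_ (xor-same x) (cong₂ _xor_ (xor-same y) (xor-inverseʳ u))) ⟩
  true ∎
  where
  open ≡-Reasoning
  open import Algebra.Solver.CommutativeMonoid xor-monoid using (solve; _⊕_; _⊜_)
  rearrange : ∀ r x y u w → ((r xor (y xor u)) xor x) xor ((r xor (x xor w)) xor y)
                          ≡ (r xor r) xor ((x xor x) xor ((y xor y) xor (u xor w)))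
  rearrange = solve 5 (λ r x y u w → ((r ⊕ (y ⊕ u)) ⊕ x) ⊕ ((r ⊕ (x ⊕ w)) ⊕ y)
                                   ⊜ (r ⊕ r) ⊕ ((x ⊕ x) ⊕ ((y ⊕ y) ⊕ (u ⊕ w)))) refl

adjacent-edges : ∀ {n m} (T : Tournament n m) (V : Subset n) a b → a ∈ V → b ∈ V → a ≢ b →
                 ∣ V ∣ ≡ suc (suc m) → (wa : EdgeOrientation T (V - a)) (wb : EdgeOrientation T (V - b)) →
                 normal-sign T V a wa xor normal-sign T V b wb ≡ true
adjacent-edges T V a b a∈V b∈V a≢b ∣V∣ wa wb = begin
  (sgn (proj₁ wa) xor par (above V a)) xor (sgn (proj₁ wb) xor par (above V b))
    ≡⟨ cong₂ (λ sa sb → (sa xor par (above V a)) xor (sb xor par (above V b))) at-a at-b ⟩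
  ((R xor (par (above V b) xor (b ≺ a))) xor par (above V a))
    xor ((R xor (par (above V a) xor not (b ≺ a))) xor par (above V b))
    ≡⟨ cross-cancel R (par (above V a)) (par (above V b)) (b ≺ a) ⟩
  true ∎
  where
  open ≡-Reasoning
  b≢a = λ b≡a → a≢b (sym b≡a)
  p = ∣V-a-b∣ V a b a∈V b∈V b≢a ∣V∣
  q = ∣V-a-b∣ V b a b∈V a∈V a≢b ∣V∣
  R = sgn (proj₁ (T (V - a - b) p))
  at-a : sgn (proj₁ wa) ≡ R xor (par (above V b) xor (b ≺ a))
  at-a = edge-sign-at-face T V a b a∈V b∈V b≢a wa p
  at-b : sgn (proj₁ wb) ≡ R xor (par (above V a) xor not (b ≺ a))
  at-b = trans (edge-sign-at-face T V b a b∈V a∈V a≢b wb q)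
               (cong₂ (λ ρ o → sgn ρ xor (par (above V a) xor o))
                      (T-irrelevant T (p─x─y≡p─y─x V b a) q p) (≺-flip b a b≢a))

no-odd-cycle : ∀ x y z → x xor y ≡ true → y xor z ≡ true → z xor x ≡ true → ⊥
no-odd-cycle true  true  _     ()
no-odd-cycle false false _     ()
no-odd-cycle true  false true  _ _ ()
no-odd-cycle true  false false _ ()
no-odd-cycle false true  true  _ ()
no-odd-cycle false true  false _ _ ()

edge-in-V : ∀ {n m} (e V : Subset n) → e ⊆ V → ∣ e ∣ ≡ suc m → ∣ V ∣ ≡ suc (suc m) → ∃[ a ] a ∈ V × e ≡ V - a
edge-in-V e V e⊆V ∣e∣ ∣V∣ = ⊆-one-smaller e V e⊆V (trans ∣V∣ (cong suc (sym ∣e∣)))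

-- H(T) is F-free.  Write the three edges inside V as V ∖ a, V ∖ b, V ∖ c;
-- their normalised signs would pairwise differ.
fact1p5 : (k : ℕ) → 2 ≤ k → (n : ℕ) → k ≤ n → (T : Tournament n (k ∸ 1)) →
    ¬ ContainsF (suc (k ∸ 1)) (HEdge T)
fact1p5 k _ n _ T (V , ∣V∣ , e₁ , e₂ , e₃ , e₁≢e₂ , e₁≢e₃ , e₂≢e₃ , e₁⊆V , e₂⊆V , e₃⊆V ,
                   (∣e₁∣ , w₁) , (∣e₂∣ , w₂) , (∣e₃∣ , w₃))
  with edge-in-V e₁ V e₁⊆V ∣e₁∣ ∣V∣ | edge-in-V e₂ V e₂⊆V ∣e₂∣ ∣V∣ | edge-in-V e₃ V e₃⊆V ∣e₃∣ ∣V∣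
... | a , a∈V , refl | b , b∈V , refl | c , c∈V , refl =
  no-odd-cycle (normal-sign T V a w₁) (normal-sign T V b w₂) (normal-sign T V c w₃)
    (adjacent-edges T V a b a∈V b∈V (distinct e₁≢e₂) ∣V∣ w₁ w₂)
    (adjacent-edges T V b c b∈V c∈V (distinct e₂≢e₃) ∣V∣ w₂ w₃)
    (adjacent-edges T V c a c∈V a∈V (distinct (λ eq → e₁≢e₃ (sym eq))) ∣V∣ w₃ w₁)
  where
  distinct : ∀ {x y} → V - x ≢ V - y → x ≢ y
  distinct V-x≢V-y x≡y = V-x≢V-y (cong (V -_) x≡y)
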